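{- For $p\in\{012,001\}$: $|\mathcal{C}_n(p)|=2^{n-1}$ for all $n\geq 1$, and for all $n\geq 2$ the popularity of descents on $\mathcal{C}_n(p)$, i.e. $\sum_{w\in\mathcal{C}_n(p)}d(w)$, equals $(n-2)\cdot 2^{n-3}$; the generating function $\sum_{n\geq 0}\big(\sum_{w\in\mathcal{C}_n(p)}d(w)\big)x^n$ equals $\frac{x^3}{(1-2x)^2}$.
   Context: A Catalan word of length $n\geq 1$ is a word $w_1\ldots w_n$ over the non-negative integers with $w_1=0$ and $0\leq w_i\leq w_{i-1}+1$ for $2\leq i\leq n$; the empty word is the unique Catalan word of length $0$. A word $w$ contains the pattern $p=p_1\ldots p_k$ if there are indices $i_1<\cdots<i_k$ such that $w_{i_1}\ldots w_{i_k}$ is order-isomorphic to $p$ (for all $a,b$: $w_{i_a}<w_{i_b}$ iff $p_a<p_b$, and $w_{i_a}=w_{i_b}$ iff $p_a=p_b$); otherwise $w$ avoids $p$. $\mathcal{C}_n(p)$ is the set of Catalan words of length $n$ avoiding $p$. A descent of $w$ is an index $i$ with $w_i>w_{i+1}$; $d(w)$ denotes the number of descents of $w$. -}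

module Defs where

open import Data.Bool.Base using (Bool; true; false; _∧_; _∨_; not; _xor_; if_then_else_)
open import Data.Nat.Base using (ℕ; zero; suc; _+_; _∸_; _≡ᵇ_; _<ᵇ_; _≤ᵇ_)
open import Data.List.Base using (List; []; _∷_; _++_; map; concatMap; upTo; filterᵇ; length; zip)
open import Data.Bool.ListAction using (all; any)
open import Data.Nat.ListAction using (sum)
open import Data.Product.Base using (_×_; _,_)
open import Data.Integer.Base as ℤ using (ℤ)

_==ᵇ_ : Bool → Bool → Bool
x ==ᵇ y = not (x xor y)

catalanStep : ℕ → List ℕ → Bool
catalanStep prev []       = true
catalanStep prev (y ∷ ys) = (y ≤ᵇ suc prev) ∧ catalanStep y ys

isCatalan : List ℕ → Bool
isCatalan []       = true
isCatalan (x ∷ xs) = (x ≡ᵇ 0) ∧ catalanStep x xs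

wordsOver : ℕ → ℕ → List (List ℕ)
wordsOver m zero    = [] ∷ []
wordsOver m (suc n) = concatMap (λ a → map (a ∷_) (wordsOver m n)) (upTo m)

subseqs : List ℕ → List (List ℕ)
subseqs []       = [] ∷ []
subseqs (x ∷ xs) = map (x ∷_) (subseqs xs) ++ subseqs xs

orderIso : List ℕ → List ℕ → Bool
orderIso u v =
  (length u ≡ᵇ length v) ∧
  all (λ { (a , a') → all (λ { (b , b') →
        ((a <ᵇ b) ==ᵇ (a' <ᵇ b')) ∧ ((a ≡ᵇ b) ==ᵇ (a' ≡ᵇ b')) }) (zip u v) })
      (zip u v)

contains : List ℕ → List ℕ → Bool
contains w p = any (λ s → orderIso s p) (subseqs w)

avoids : List ℕ → List ℕ → Bool
avoids w p = not (contains w p)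

-- 𝒞ₙ(p): Catalan words of length n avoiding p.  Every Catalan word of
-- length n has letters ≤ n-1, so enumerating words over {0,…,n-1} is complete.
C : ℕ → List ℕ → List (List ℕ)
C n p = filterᵇ (λ w → isCatalan w ∧ avoids w p) (wordsOver n n)

des : List ℕ → ℕ
des []           = 0
des (x ∷ [])     = 0
des (x ∷ y ∷ ys) = (if y <ᵇ x then 1 else 0) + des (y ∷ ys)

popDes : ℕ → List ℕ → ℕ
popDes n p = sum (map des (C n p))

PowerSeries : Set
PowerSeries = ℕ → ℤ

convSum : (ℕ → ℤ) → (ℕ → ℤ) → ℕ → ℕ → ℤ
convSum f g n zero    = f 0 ℤ.* g n
convSum f g n (suc k) = f (suc k) ℤ.* g (n ∸ suc k) ℤ.+ convSum f g n k

_⊛_ : PowerSeries → PowerSeries → PowerSeries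
(f ⊛ g) n = convSum f g n n

oneMinusTwoX : PowerSeries
oneMinusTwoX zero          = ℤ.+ 1
oneMinusTwoX (suc zero)    = ℤ.- (ℤ.+ 2)
oneMinusTwoX (suc (suc n)) = ℤ.+ 0

xCubed : PowerSeries
xCubed 3 = ℤ.+ 1
xCubed _ = ℤ.+ 0

descentGF : List ℕ → PowerSeries
descentGF p n = ℤ.+ (popDes n p)

-- A Catalan word avoids 012 iff it is 0 followed by a word over {0, 1}, and avoids 001 iff it
-- climbs 0 1 … p and then weakly decreases.  Both classes are recognised letter by letter by a
-- small automaton, and running the automaton over the enumeration of words turns the number
-- of accepted words and their total number of descents into recurrences.  Solving them gives
-- 2^(n-1) words and (n-2)·2^(n-3) descents in both cases (for 001 through the hockey-stick and
-- absorption identities for C(p + k, k)).  The generating-function identity says that the second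
-- difference a(n) - 4 a(n-1) + 4 a(n-2) of the descent totals is 1 at n = 3 and 0 elsewhere.
module Submission where

open import Defs
open import Data.Bool.Base using (Bool; true; false; _∧_; _∨_; not; if_then_else_; T)
open import Data.Nat.Base using (ℕ; zero; suc; _+_; _*_; _∸_; _^_; _≤_; _<_; s≤s; z≤n; _<ᵇ_; _≤ᵇ_; _≡ᵇ_)
open import Data.List.Base using (List; []; _∷_; _++_; map; concatMap; applyUpTo; upTo; filterᵇ; length)
open import Data.Nat.ListAction using (sum)
open import Data.Bool.ListAction using (any)
open import Data.Bool.Properties using (∨-assoc; ∨-identityʳ; ∨-zeroʳ; T-≡; ¬-not)
open import Data.Nat.ListAction.Properties using (sum-++)
open import Data.List.Properties using (length-map; length-++; map-++; map-∘; filter-++; ++-identityʳ)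
open import Data.Sum.Base using (_⊎_; inj₁; inj₂)
open import Data.List.Relation.Unary.All using (All; []; _∷_)
open import Data.Product.Base using (Σ; _×_; _,_; proj₁; proj₂)
open import Function.Base using (_∘_; case_of_)
open import Function.Bundles using (Equivalence)
open import Relation.Nullary.Decidable using (T?)
open import Relation.Binary.PropositionalEquality
  using (_≡_; _≢_; refl; sym; trans; cong; cong₂; subst; module ≡-Reasoning)
import Data.Nat.Properties as ℕₚ
open import Data.Nat.Tactic.RingSolver using (solve-∀)
import Data.Integer.Base as ℤ
import Data.Integer.Properties as ℤₚ
import Data.Integer.Tactic.RingSolver as ℤ-Solver
open import Algebra.Properties.CommutativeSemigroup ℕₚ.+-commutativeSemigroup using (x∙yz≈y∙xz) renaming (interchange to +-interchange)

sumBelow : ℕ → (ℕ → ℕ) → ℕ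
sumBelow zero    f = 0
sumBelow (suc n) f = f 0 + sumBelow n (λ i → f (suc i))

sumBelow-cong : ∀ n {f g : ℕ → ℕ} → (∀ i → i < n → f i ≡ g i) → sumBelow n f ≡ sumBelow n g
sumBelow-cong zero    eq = refl
sumBelow-cong (suc n) eq = cong₂ _+_ (eq 0 (s≤s z≤n)) (sumBelow-cong n (λ i i<n → eq (suc i) (s≤s i<n)))

sumBelow-0 : ∀ n → sumBelow n (λ _ → 0) ≡ 0
sumBelow-0 zero    = refl
sumBelow-0 (suc n) = sumBelow-0 n

sumBelow-truncate : ∀ {r m} (f : ℕ → ℕ) → r ≤ m → sumBelow m (λ a → if a <ᵇ r then f a else 0) ≡ sumBelow r f
sumBelow-truncate {zero}  {m}     f _         = sumBelow-0 m
sumBelow-truncate {suc r} {suc m} f (s≤s r≤m) = cong (f 0 +_) (sumBelow-truncate (λ i → f (suc i)) r≤m)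

sumBelow-last : ∀ n (f : ℕ → ℕ) → sumBelow (suc n) f ≡ sumBelow n f + f n
sumBelow-last zero    f = ℕₚ.+-comm (f 0) 0
sumBelow-last (suc n) f = trans (cong (f 0 +_) (sumBelow-last n (λ i → f (suc i)))) (sym (ℕₚ.+-assoc (f 0) _ _))

sumBelow-+ : ∀ n (f g : ℕ → ℕ) → sumBelow n (λ a → f a + g a) ≡ sumBelow n f + sumBelow n g
sumBelow-+ zero    f g = refl
sumBelow-+ (suc n) f g = trans (cong ((f 0 + g 0) +_) (sumBelow-+ n (λ i → f (suc i)) (λ i → g (suc i))))
                               (+-interchange (f 0) (g 0) _ _)

sumBelow-* : ∀ n k (f : ℕ → ℕ) → sumBelow n (λ a → k * f a) ≡ k * sumBelow n f
sumBelow-* zero    k f = sym (ℕₚ.*-zeroʳ k)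
sumBelow-* (suc n) k f = trans (cong (k * f 0 +_) (sumBelow-* n k (λ i → f (suc i)))) (sym (ℕₚ.*-distribˡ-+ k (f 0) _))

sum-map-applyUpTo : ∀ (f g : ℕ → ℕ) n → sum (map f (applyUpTo g n)) ≡ sumBelow n (f ∘ g)
sum-map-applyUpTo f g zero    = refl
sum-map-applyUpTo f g (suc n) = cong (f (g 0) +_) (sum-map-applyUpTo f (g ∘ suc) n)

filter-concatMap : ∀ {A B : Set} (p : B → Bool) (F : A → List B) xs →
                   filterᵇ p (concatMap F xs) ≡ concatMap (filterᵇ p ∘ F) xs
filter-concatMap p F []       = refl
filter-concatMap p F (x ∷ xs) =
  trans (filter-++ (T? ∘ p) (F x) _) (cong (filterᵇ p (F x) ++_) (filter-concatMap p F xs))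

filterᵇ-cong : ∀ {A : Set} {p q : A → Bool} → (∀ x → p x ≡ q x) → ∀ xs → filterᵇ p xs ≡ filterᵇ q xs
filterᵇ-cong             eq []       = refl
filterᵇ-cong {p = p} {q} eq (x ∷ xs) with p x | q x | eq x
... | true  | .true  | refl = cong (x ∷_) (filterᵇ-cong eq xs)
... | false | .false | refl = filterᵇ-cong eq xs

concatMap-applyUpTo-[] : ∀ {B : Set} {F : ℕ → List B} (g : ℕ → ℕ) → (∀ i → F (g i) ≡ []) →
                         ∀ n → concatMap F (applyUpTo g n) ≡ []
concatMap-applyUpTo-[] g eq zero    = refl
concatMap-applyUpTo-[] g eq (suc n) rewrite eq 0 = concatMap-applyUpTo-[] (λ i → g (suc i)) (λ i → eq (suc i)) n

module _ {B : Set} (h : List B → ℕ) (h-[] : h [] ≡ 0)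
         (h-++ : ∀ xs ys → h (xs ++ ys) ≡ h xs + h ys) where

  additive-concatMap : ∀ {A : Set} (F : A → List B) xs → h (concatMap F xs) ≡ sum (map (h ∘ F) xs)
  additive-concatMap F []       = h-[]
  additive-concatMap F (x ∷ xs) = trans (h-++ (F x) _) (cong (h (F x) +_) (additive-concatMap F xs))

  additive-filter-concatMap-upTo : ∀ (p : B → Bool) (F : ℕ → List B) n →
    h (filterᵇ p (concatMap F (upTo n))) ≡ sumBelow n (λ a → h (filterᵇ p (F a)))
  additive-filter-concatMap-upTo p F n = begin
    h (filterᵇ p (concatMap F (upTo n)))           ≡⟨ cong h (filter-concatMap p F (upTo n)) ⟩
    h (concatMap (filterᵇ p ∘ F) (upTo n))         ≡⟨ additive-concatMap (filterᵇ p ∘ F) (upTo n) ⟩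
    sum (map (h ∘ filterᵇ p ∘ F) (upTo n))         ≡⟨ sum-map-applyUpTo (h ∘ filterᵇ p ∘ F) (λ i → i) n ⟩
    sumBelow n (λ a → h (filterᵇ p (F a)))         ∎
    where open ≡-Reasoning

sum-map-++ : ∀ {A : Set} (f : A → ℕ) xs ys → sum (map f (xs ++ ys)) ≡ sum (map f xs) + sum (map f ys)
sum-map-++ f xs ys = trans (cong sum (map-++ f xs ys)) (sum-++ (map f xs) (map f ys))

sum-map-suc : ∀ {A : Set} (f : A → ℕ) xs → sum (map (suc ∘ f) xs) ≡ length xs + sum (map f xs)
sum-map-suc f []       = refl
sum-map-suc f (x ∷ xs) = cong suc (trans (cong (f x +_) (sum-map-suc f xs)) (x∙yz≈y∙xz (f x) (length xs) _))

∧≡true : ∀ {x y} → x ∧ y ≡ true → x ≡ true × y ≡ true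
∧≡true {true} y≡true = refl , y≡true

≡true⇒T : ∀ {x} → x ≡ true → T x
≡true⇒T = Equivalence.from T-≡

T⇒≡true : ∀ {x} → T x → x ≡ true
T⇒≡true = Equivalence.to T-≡

true∧≡false : ∀ {x y} → x ≡ true → x ∧ y ≡ false → y ≡ false
true∧≡false refl y≡false = y≡false

<ᵇ≡true⇒< : ∀ {m n} → (m <ᵇ n) ≡ true → m < n
<ᵇ≡true⇒< {m} {n} = ℕₚ.<ᵇ⇒< m n ∘ ≡true⇒T

<⇒<ᵇ≡true : ∀ {m n} → m < n → (m <ᵇ n) ≡ true
<⇒<ᵇ≡true = T⇒≡true ∘ ℕₚ.<⇒<ᵇ

≤ᵇ≡true⇒≤ : ∀ {m n} → (m ≤ᵇ n) ≡ true → m ≤ n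
≤ᵇ≡true⇒≤ {m} {n} = ℕₚ.≤ᵇ⇒≤ m n ∘ ≡true⇒T

≤⇒≤ᵇ≡true : ∀ {m n} → m ≤ n → (m ≤ᵇ n) ≡ true
≤⇒≤ᵇ≡true = T⇒≡true ∘ ℕₚ.≤⇒≤ᵇ

<ᵇ≡false⇒≥ : ∀ {m n} → (m <ᵇ n) ≡ false → n ≤ m
<ᵇ≡false⇒≥ m≮ᵇn = ℕₚ.≮⇒≥ (λ m<n → case trans (sym (<⇒<ᵇ≡true m<n)) m≮ᵇn of λ ())

≤ᵇ≡false⇒> : ∀ {m n} → (m ≤ᵇ n) ≡ false → n < m
≤ᵇ≡false⇒> m≰ᵇn = ℕₚ.≰⇒> (λ m≤n → case trans (sym (≤⇒≤ᵇ≡true m≤n)) m≰ᵇn of λ ())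

<ᵇ-suc : ∀ m n → (m <ᵇ suc n) ≡ (m ≤ᵇ n)
<ᵇ-suc zero    n = refl
<ᵇ-suc (suc m) n = refl

<ᵇ-irrefl : ∀ n → (n <ᵇ n) ≡ false
<ᵇ-irrefl zero    = refl
<ᵇ-irrefl (suc n) = <ᵇ-irrefl n

suc<ᵇ : ∀ n → (suc n <ᵇ n) ≡ false
suc<ᵇ zero    = refl
suc<ᵇ (suc n) = suc<ᵇ n

∧≡true₃ : ∀ {x y z} → x ∧ (y ∧ (z ∧ true)) ≡ true → x ≡ true × y ≡ true × z ≡ true
∧≡true₃ {true} {true} {true} _ = refl , refl , refl

==ᵇtrue : ∀ {x} → (x ==ᵇ true) ≡ true → x ≡ true
==ᵇtrue {true} _ = refl

sum-des-cons : ∀ c a V → sum (map (λ w → des (c ∷ w)) (map (a ∷_) V))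
             ≡ (if a <ᵇ c then length V else 0) + sum (map (λ w → des (a ∷ w)) V)
sum-des-cons c a V rewrite sym (map-∘ {g = λ w → des (c ∷ w)} {f = a ∷_} V) with a <ᵇ c
... | true  = sum-map-suc (λ w → des (a ∷ w)) V
... | false = refl

module Automaton {State : Set} (allowed : State → ℕ → Bool) (step : State → ℕ → State)
                 (lastLetter : State → ℕ)
                 (lastLetter-step : ∀ s a → lastLetter (step s a) ≡ a) where

  accepts : State → List ℕ → Bool
  accepts s []      = true
  accepts s (a ∷ w) = allowed s a ∧ accepts (step s a) w

  accepted : ℕ → State → ℕ → List (List ℕ)
  accepted m s k = filterᵇ (accepts s) (wordsOver m k)

  count : ℕ → State → ℕ → ℕ
  count m s k = length (accepted m s k)

  -- Includes the possible descent from the letter remembered by s into the first letter of w.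
  descents : ℕ → State → ℕ → ℕ
  descents m s k = sum (map (λ w → des (lastLetter s ∷ w)) (accepted m s k))

  filter-accepts-prefix : ∀ s a W → filterᵇ (accepts s) (map (a ∷_) W)
                        ≡ (if allowed s a then map (a ∷_) (filterᵇ (accepts (step s a)) W) else [])
  filter-accepts-prefix s a [] with allowed s a
  ... | true  = refl
  ... | false = refl
  filter-accepts-prefix s a (w ∷ W) with allowed s a | filter-accepts-prefix s a W
  ... | false | ih = ih
  ... | true  | ih with accepts (step s a) w
  ...   | true  = cong ((a ∷ w) ∷_) ih
  ...   | false = ih

  count-prefix : ∀ s a W → length (filterᵇ (accepts s) (map (a ∷_) W))
               ≡ (if allowed s a then length (filterᵇ (accepts (step s a)) W) else 0)
  count-prefix s a W rewrite filter-accepts-prefix s a W with allowed s a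
  ... | true  = length-map (a ∷_) (filterᵇ (accepts (step s a)) W)
  ... | false = refl

  descents-prefix : ∀ s a W →
    sum (map (λ w → des (lastLetter s ∷ w)) (filterᵇ (accepts s) (map (a ∷_) W)))
    ≡ (if allowed s a
         then (if a <ᵇ lastLetter s then length (filterᵇ (accepts (step s a)) W) else 0)
              + sum (map (λ w → des (lastLetter (step s a) ∷ w)) (filterᵇ (accepts (step s a)) W))
         else 0)
  descents-prefix s a W rewrite filter-accepts-prefix s a W | lastLetter-step s a with allowed s a
  ... | true  = sum-des-cons (lastLetter s) a (filterᵇ (accepts (step s a)) W)
  ... | false = refl

  count-suc : ∀ m s k → count m s (suc k) ≡ sumBelow m (λ a → if allowed s a then count m (step s a) k else 0)
  count-suc m s k =
    trans (additive-filter-concatMap-upTo length refl (λ xs ys → length-++ xs) (accepts s) _ m)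
          (sumBelow-cong m (λ a _ → count-prefix s a (wordsOver m k)))

  descents-suc : ∀ m s k → descents m s (suc k) ≡ sumBelow m (λ a →
    if allowed s a then (if a <ᵇ lastLetter s then count m (step s a) k else 0) + descents m (step s a) k else 0)
  descents-suc m s k =
    trans (additive-filter-concatMap-upTo (sum ∘ map (λ w → des (lastLetter s ∷ w))) refl
             (sum-map-++ (λ w → des (lastLetter s ∷ w))) (accepts s) _ m)
          (sumBelow-cong m (λ a _ → descents-prefix s a (wordsOver m k)))

zeroThen : (List ℕ → Bool) → List ℕ → Bool
zeroThen A []       = true
zeroThen A (x ∷ xs) = (x ≡ᵇ 0) ∧ A xs

filter-zeroThen-words : ∀ A m k →
  filterᵇ (zeroThen A) (wordsOver (suc m) (suc k)) ≡ map (0 ∷_) (filterᵇ A (wordsOver (suc m) k))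
filter-zeroThen-words A m k = begin
  filterᵇ (zeroThen A) (map (0 ∷_) W ++ concatMap (λ a → map (a ∷_) W) (applyUpTo suc m))
    ≡⟨ filter-++ (T? ∘ zeroThen A) (map (0 ∷_) W) _ ⟩
  filterᵇ (zeroThen A) (map (0 ∷_) W) ++ filterᵇ (zeroThen A) (concatMap (λ a → map (a ∷_) W) (applyUpTo suc m))
    ≡⟨ cong₂ _++_ (accept-zero W) (trans (filter-concatMap (zeroThen A) _ (applyUpTo suc m))
                                         (concatMap-applyUpTo-[] suc (λ a → reject-nonzero a W) m)) ⟩
  map (0 ∷_) (filterᵇ A W) ++ []
    ≡⟨ ++-identityʳ _ ⟩
  map (0 ∷_) (filterᵇ A W) ∎
  where
  open ≡-Reasoning
  W : List (List ℕ)
  W = wordsOver (suc m) k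

  accept-zero : ∀ V → filterᵇ (zeroThen A) (map (0 ∷_) V) ≡ map (0 ∷_) (filterᵇ A V)
  accept-zero []      = refl
  accept-zero (v ∷ V) with A v
  ... | true  = cong ((0 ∷ v) ∷_) (accept-zero V)
  ... | false = accept-zero V

  reject-nonzero : ∀ a V → filterᵇ (zeroThen A) (map (suc a ∷_) V) ≡ []
  reject-nonzero a []      = refl
  reject-nonzero a (v ∷ V) = reject-nonzero a V

module _ (p : List ℕ) (A : List ℕ → Bool) (characterisation : ∀ w → isCatalan w ∧ avoids w p ≡ zeroThen A w) where

  C-suc : ∀ k → C (suc k) p ≡ map (0 ∷_) (filterᵇ A (wordsOver (suc k) k))
  C-suc k = trans (filterᵇ-cong characterisation (wordsOver (suc k) (suc k))) (filter-zeroThen-words A k k)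

  length-C : ∀ k → length (C (suc k) p) ≡ length (filterᵇ A (wordsOver (suc k) k))
  length-C k = trans (cong length (C-suc k)) (length-map (0 ∷_) (filterᵇ A (wordsOver (suc k) k)))

  popDes-C : ∀ k → popDes (suc k) p ≡ sum (map (λ w → des (0 ∷ w)) (filterᵇ A (wordsOver (suc k) k)))
  popDes-C k = trans (cong (sum ∘ map des) (C-suc k)) (cong sum (sym (map-∘ (filterᵇ A (wordsOver (suc k) k)))))

anyPair : (ℕ → ℕ → Bool) → List ℕ → Bool
anyPair R []       = false
anyPair R (x ∷ xs) = any (R x) xs ∨ anyPair R xs

anyTriple : (ℕ → ℕ → ℕ → Bool) → List ℕ → Bool
anyTriple R []       = false
anyTriple R (x ∷ xs) = anyPair (R x) xs ∨ anyTriple R xs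

any-++ : ∀ {A : Set} (F : A → Bool) xs ys → any F (xs ++ ys) ≡ any F xs ∨ any F ys
any-++ F []       ys = refl
any-++ F (x ∷ xs) ys = trans (cong (F x ∨_) (any-++ F xs ys)) (sym (∨-assoc (F x) _ _))

any-map : ∀ {A B : Set} (F : B → Bool) (g : A → B) xs → any F (map g xs) ≡ any (F ∘ g) xs
any-map F g []       = refl
any-map F g (x ∷ xs) = cong (F (g x) ∨_) (any-map F g xs)

any-subseqs-∷ : ∀ (F : List ℕ → Bool) x xs →
  any F (subseqs (x ∷ xs)) ≡ any (λ s → F (x ∷ s)) (subseqs xs) ∨ any F (subseqs xs)
any-subseqs-∷ F x xs =
  trans (any-++ F (map (x ∷_) (subseqs xs)) _) (cong (_∨ any F (subseqs xs)) (any-map F (x ∷_) (subseqs xs)))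

any-false : ∀ {A : Set} {F : A → Bool} → (∀ x → F x ≡ false) → ∀ xs → any F xs ≡ false
any-false eq []       = refl
any-false eq (x ∷ xs) = cong₂ _∨_ (eq x) (any-false eq xs)

any-subseqs-nil : ∀ (F : List ℕ → Bool) → (∀ a s → F (a ∷ s) ≡ false) →
                  ∀ xs → any F (subseqs xs) ≡ F []
any-subseqs-nil F F≡false []       = ∨-identityʳ (F [])
any-subseqs-nil F F≡false (x ∷ xs) =
  trans (any-subseqs-∷ F x xs)
        (cong₂ _∨_ (any-false (F≡false x) (subseqs xs)) (any-subseqs-nil F F≡false xs))

any-subseqs-singleton : ∀ (F : List ℕ → Bool) → F [] ≡ false → (∀ a b s → F (a ∷ b ∷ s) ≡ false) →
                        ∀ xs → any F (subseqs xs) ≡ any (λ a → F (a ∷ [])) xs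
any-subseqs-singleton F F0 F2 []       = trans (∨-identityʳ (F [])) F0
any-subseqs-singleton F F0 F2 (x ∷ xs) =
  trans (any-subseqs-∷ F x xs)
        (cong₂ _∨_ (any-subseqs-nil (λ s → F (x ∷ s)) (F2 x) xs) (any-subseqs-singleton F F0 F2 xs))

any-subseqs-pair : ∀ (F : List ℕ → Bool) → F [] ≡ false → (∀ a → F (a ∷ []) ≡ false) →
                   (∀ a b c s → F (a ∷ b ∷ c ∷ s) ≡ false) →
                   ∀ xs → any F (subseqs xs) ≡ anyPair (λ a b → F (a ∷ b ∷ [])) xs
any-subseqs-pair F F0 F1 F3 []       = trans (∨-identityʳ (F [])) F0
any-subseqs-pair F F0 F1 F3 (x ∷ xs) =
  trans (any-subseqs-∷ F x xs)
        (cong₂ _∨_ (any-subseqs-singleton (λ s → F (x ∷ s)) (F1 x) (F3 x) xs) (any-subseqs-pair F F0 F1 F3 xs))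

any-subseqs-triple : ∀ (F : List ℕ → Bool) → F [] ≡ false → (∀ a → F (a ∷ []) ≡ false) →
                     (∀ a b → F (a ∷ b ∷ []) ≡ false) → (∀ a b c d s → F (a ∷ b ∷ c ∷ d ∷ s) ≡ false) →
                     ∀ xs → any F (subseqs xs) ≡ anyTriple (λ a b c → F (a ∷ b ∷ c ∷ [])) xs
any-subseqs-triple F F0 F1 F2 F4 []       = trans (∨-identityʳ (F [])) F0
any-subseqs-triple F F0 F1 F2 F4 (x ∷ xs) =
  trans (any-subseqs-∷ F x xs)
        (cong₂ _∨_ (any-subseqs-pair (λ s → F (x ∷ s)) (F1 x) (F2 x) (F4 x) xs) (any-subseqs-triple F F0 F1 F2 F4 xs))

contains-triple : ∀ q₁ q₂ q₃ w →
  contains w (q₁ ∷ q₂ ∷ q₃ ∷ []) ≡ anyTriple (λ a b c → orderIso (a ∷ b ∷ c ∷ []) (q₁ ∷ q₂ ∷ q₃ ∷ [])) w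
contains-triple q₁ q₂ q₃ =
  any-subseqs-triple (λ s → orderIso s (q₁ ∷ q₂ ∷ q₃ ∷ [])) refl (λ _ → refl) (λ _ _ → refl) (λ _ _ _ _ _ → refl)

module Binary = Automaton (λ _ a → a <ᵇ 2) (λ _ a → a) (λ s → s) (λ _ _ → refl)

iso012 : ℕ → ℕ → ℕ → Bool
iso012 a b c = orderIso (a ∷ b ∷ c ∷ []) (0 ∷ 1 ∷ 2 ∷ [])

data Bit : ℕ → Set where
  bit0 : Bit 0
  bit1 : Bit 1

iso012-bits : ∀ {a b c} → Bit a → Bit b → Bit c → iso012 a b c ≡ false
iso012-bits bit0 bit0 bit0 = refl
iso012-bits bit0 bit0 bit1 = refl
iso012-bits bit0 bit1 bit0 = refl
iso012-bits bit0 bit1 bit1 = refl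
iso012-bits bit1 bit0 bit0 = refl
iso012-bits bit1 bit0 bit1 = refl
iso012-bits bit1 bit1 bit0 = refl
iso012-bits bit1 bit1 bit1 = refl

all-bits : ∀ s xs → Binary.accepts s xs ≡ true → All Bit xs
all-bits s []                 _  = []
all-bits s (zero ∷ xs)        ok = bit0 ∷ all-bits 0 xs ok
all-bits s (suc zero ∷ xs)    ok = bit1 ∷ all-bits 1 xs ok
all-bits s (suc (suc _) ∷ xs) ()

binary-catalanStep : ∀ {a} → Bit a → ∀ xs → All Bit xs → catalanStep a xs ≡ true
binary-catalanStep _    []       _             = refl
binary-catalanStep bit0 (_ ∷ xs) (bit0 ∷ bits) = binary-catalanStep bit0 xs bits
binary-catalanStep bit0 (_ ∷ xs) (bit1 ∷ bits) = binary-catalanStep bit1 xs bits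
binary-catalanStep bit1 (_ ∷ xs) (bit0 ∷ bits) = binary-catalanStep bit0 xs bits
binary-catalanStep bit1 (_ ∷ xs) (bit1 ∷ bits) = binary-catalanStep bit1 xs bits

binary-avoids-012 : ∀ xs → All Bit xs → anyTriple iso012 xs ≡ false
binary-avoids-012 []       _             = refl
binary-avoids-012 (x ∷ xs) (bx ∷ bits) = cong₂ _∨_ (no-pair bx xs bits) (binary-avoids-012 xs bits)
  where
  no-single : ∀ {a b} → Bit a → Bit b → ∀ xs → All Bit xs → any (iso012 a b) xs ≡ false
  no-single ba bb []       _             = refl
  no-single ba bb (z ∷ zs) (bz ∷ bits) = cong₂ _∨_ (iso012-bits ba bb bz) (no-single ba bb zs bits)

  no-pair : ∀ {a} → Bit a → ∀ xs → All Bit xs → anyPair (iso012 a) xs ≡ false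
  no-pair ba []       _             = refl
  no-pair ba (z ∷ zs) (bz ∷ bits) = cong₂ _∨_ (no-single ba bz zs bits) (no-pair ba zs bits)

-- Reading a Catalan word from a letter in {0, 1}, the first letter outside {0, 1} is a 2 directly after a 1.
mutual
  nonbinary-after-0 : ∀ xs → catalanStep 0 xs ≡ true → Binary.accepts 0 xs ≡ false →
                      anyPair (iso012 0) xs ≡ true
  nonbinary-after-0 []                 _   ()
  nonbinary-after-0 (zero ∷ xs)        cat rej =
    trans (cong (any (iso012 0 0) xs ∨_) (nonbinary-after-0 xs cat rej)) (∨-zeroʳ _)
  nonbinary-after-0 (suc zero ∷ xs)    cat rej = nonbinary-after-01 xs cat rej
  nonbinary-after-0 (suc (suc _) ∷ xs) ()  _

  nonbinary-after-01 : ∀ xs → catalanStep 1 xs ≡ true → Binary.accepts 1 xs ≡ false →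
                       any (iso012 0 1) xs ∨ anyPair (iso012 0) xs ≡ true
  nonbinary-after-01 []                       _   ()
  nonbinary-after-01 (zero ∷ xs)              cat rej =
    trans (cong (any (iso012 0 1) (0 ∷ xs) ∨_)
                (trans (cong (any (iso012 0 0) xs ∨_) (nonbinary-after-0 xs cat rej)) (∨-zeroʳ _)))
          (∨-zeroʳ _)
  nonbinary-after-01 (suc zero ∷ xs)          cat rej =
    trans (cong (any (iso012 0 1) (1 ∷ xs) ∨_) (nonbinary-after-01 xs cat rej)) (∨-zeroʳ _)
  nonbinary-after-01 (suc (suc zero) ∷ xs)    cat rej = refl
  nonbinary-after-01 (suc (suc (suc _)) ∷ xs) ()  _

avoid-012-characterisation : ∀ w → isCatalan w ∧ avoids w (0 ∷ 1 ∷ 2 ∷ []) ≡ zeroThen (Binary.accepts 0) w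
avoid-012-characterisation []          = refl
avoid-012-characterisation (suc _ ∷ _) = refl
avoid-012-characterisation (zero ∷ xs) rewrite contains-triple 0 1 2 (zero ∷ xs) with Binary.accepts 0 xs in ok
... | true  = let bits = all-bits 0 xs ok in
  cong₂ (λ u v → u ∧ not v) (binary-catalanStep bit0 xs bits) (binary-avoids-012 (0 ∷ xs) (bit0 ∷ bits))
... | false with catalanStep 0 xs in cat
...   | false = refl
...   | true  = cong (λ v → not (v ∨ anyTriple iso012 xs)) (nonbinary-after-0 xs cat ok)

module BinaryCounts {m} (2≤m : 2 ≤ m) where
  open Binary using (count; descents; count-suc; descents-suc)
  open ≡-Reasoning

  count-binary : ∀ s k → count m s k ≡ 2 ^ k
  count-binary s zero    = refl
  count-binary s (suc k) = begin
    count m s (suc k)                                        ≡⟨ count-suc m s k ⟩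
    sumBelow m (λ a → if a <ᵇ 2 then count m a k else 0)    ≡⟨ sumBelow-truncate (λ a → count m a k) 2≤m ⟩
    count m 0 k + (count m 1 k + 0)                          ≡⟨ cong₂ (λ x y → x + (y + 0)) (count-binary 0 k) (count-binary 1 k) ⟩
    2 ^ suc k                                                ∎

  descentsBoth : ℕ → ℕ
  descentsBoth k = descents m 0 k + descents m 1 k

  descents-after-0 : ∀ k → descents m 0 (suc k) ≡ descentsBoth k
  descents-after-0 k = begin
    descents m 0 (suc k)                   ≡⟨ descents-suc m 0 k ⟩
    sumBelow m _                           ≡⟨ sumBelow-truncate (λ a → descents m a k) 2≤m ⟩
    descents m 0 k + (descents m 1 k + 0)  ≡⟨ cong (descents m 0 k +_) (ℕₚ.+-identityʳ _) ⟩
    descentsBoth k                         ∎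

  descentsBoth-suc : ∀ k → descentsBoth (suc k) ≡ 2 ^ k + 2 * descentsBoth k
  descentsBoth-suc k = begin
    descents m 0 (suc k) + descents m 1 (suc k)
      ≡⟨ cong₂ _+_ (descents-after-0 k)
                   (trans (descents-suc m 1 k) (sumBelow-truncate (λ a → (if a <ᵇ 1 then count m a k else 0) + descents m a k) 2≤m)) ⟩
    descentsBoth k + ((count m 0 k + descents m 0 k) + (descents m 1 k + 0))
      ≡⟨ cong (λ c → descentsBoth k + ((c + descents m 0 k) + (descents m 1 k + 0))) (count-binary 0 k) ⟩
    descentsBoth k + ((2 ^ k + descents m 0 k) + (descents m 1 k + 0))
      ≡⟨ rearrange (2 ^ k) (descents m 0 k) (descents m 1 k) ⟩
    2 ^ k + 2 * descentsBoth k ∎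
    where
    rearrange : ∀ c x y → (x + y) + ((c + x) + (y + 0)) ≡ c + 2 * (x + y)
    rearrange = solve-∀

  descentsBoth-closed : ∀ j → descentsBoth (suc j) ≡ suc j * 2 ^ j
  descentsBoth-closed zero    = descentsBoth-suc 0
  descentsBoth-closed (suc j) = begin
    descentsBoth (suc (suc j))          ≡⟨ descentsBoth-suc (suc j) ⟩
    2 ^ suc j + 2 * descentsBoth (suc j) ≡⟨ cong (λ d → 2 ^ suc j + 2 * d) (descentsBoth-closed j) ⟩
    2 ^ suc j + 2 * (suc j * 2 ^ j)      ≡⟨ double (2 ^ j) j ⟩
    suc (suc j) * 2 ^ suc j              ∎
    where
    double : ∀ x j → 2 * x + 2 * (suc j * x) ≡ suc (suc j) * (2 * x)
    double = solve-∀

-- rising p: the letters read so far are 0 1 … p.  falling p: some letter has been repeated and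
-- the last letter is p; from then on a 001-avoiding word can only weakly decrease.
data Phase : Set where
  rising falling : ℕ → Phase

allowed001 : Phase → ℕ → Bool
allowed001 (rising p)  a = a <ᵇ suc (suc p)
allowed001 (falling p) a = a <ᵇ suc p

step001 : Phase → ℕ → Phase
step001 (rising p)  a = if a ≤ᵇ p then falling a else rising a
step001 (falling _) a = falling a

phaseLetter : Phase → ℕ
phaseLetter (rising p)  = p
phaseLetter (falling p) = p

phaseLetter-step001 : ∀ s a → phaseLetter (step001 s a) ≡ a
phaseLetter-step001 (rising p)  a with a ≤ᵇ p
... | true  = refl
... | false = refl
phaseLetter-step001 (falling _) a = refl

module Phased = Automaton allowed001 step001 phaseLetter phaseLetter-step001

step001-≤ : ∀ {p a} → a ≤ p → step001 (rising p) a ≡ falling a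
step001-≤ {p} {a} a≤p rewrite ≤⇒≤ᵇ≡true {a} {p} a≤p = refl

step001-suc : ∀ p → step001 (rising p) (suc p) ≡ rising (suc p)
step001-suc p rewrite <ᵇ-irrefl p = refl

iso001 : ℕ → ℕ → ℕ → Bool
iso001 a b c = orderIso (a ∷ b ∷ c ∷ []) (0 ∷ 0 ∷ 1 ∷ [])

iso001-sound : ∀ {a b c} → iso001 a b c ≡ true → a ≡ b × b < c
iso001-sound {a} {b} {c} iso =
  ℕₚ.≡ᵇ⇒≡ a b (≡true⇒T (==ᵇtrue (proj₂ (∧≡true a~b)))) , <ᵇ≡true⇒< (==ᵇtrue (proj₁ (∧≡true b~c)))
  where
  agree : ℕ → ℕ → ℕ → ℕ → Bool
  agree x x' y y' = ((x <ᵇ y) ==ᵇ (x' <ᵇ y')) ∧ ((x ≡ᵇ y) ==ᵇ (x' ≡ᵇ y'))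

  row : ℕ → ℕ → Bool
  row x x' = agree x x' a 0 ∧ (agree x x' b 0 ∧ (agree x x' c 1 ∧ true))

  entries : ∀ x x' → row x x' ≡ true →
            agree x x' a 0 ≡ true × agree x x' b 0 ≡ true × agree x x' c 1 ≡ true
  entries x x' = ∧≡true₃ {agree x x' a 0} {agree x x' b 0} {agree x x' c 1}

  rows : row a 0 ≡ true × row b 0 ≡ true × row c 1 ≡ true
  rows = ∧≡true₃ {row a 0} {row b 0} {row c 1} iso

  a~b : agree a 0 b 0 ≡ true
  a~b = proj₁ (proj₂ (entries a 0 (proj₁ rows)))

  b~c : agree b 0 c 1 ≡ true
  b~c = proj₂ (proj₂ (entries b 0 (proj₁ (proj₂ rows))))

iso001-repeat-rise : ∀ q → iso001 q q (suc q) ≡ true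
iso001-repeat-rise zero    = refl
iso001-repeat-rise (suc q) = iso001-repeat-rise q

iso001-≢ : ∀ {a b} c → a ≢ b → iso001 a b c ≡ false
iso001-≢ c a≢b = ¬-not (a≢b ∘ proj₁ ∘ iso001-sound)

iso001-≥ : ∀ a {b c} → c ≤ b → iso001 a b c ≡ false
iso001-≥ a c≤b = ¬-not (λ iso → ℕₚ.<⇒≱ (proj₂ (iso001-sound {a} iso)) c≤b)

falling-below : ∀ x {b q} zs → q ≤ b → Phased.accepts (falling q) zs ≡ true → any (iso001 x b) zs ≡ false
falling-below x []       q≤b _  = refl
falling-below x (z ∷ zs) q≤b ok with z<q+1 , ok′ ← ∧≡true ok =
  let z≤b = ℕₚ.≤-trans (ℕₚ.m<1+n⇒m≤n (<ᵇ≡true⇒< z<q+1)) q≤b in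
  cong₂ _∨_ (iso001-≥ x z≤b) (falling-below x zs z≤b ok′)

falling-no-pair : ∀ x {q} ys → Phased.accepts (falling q) ys ≡ true → anyPair (iso001 x) ys ≡ false
falling-no-pair x []       _  = refl
falling-no-pair x (y ∷ ys) ok =
  cong₂ _∨_ (falling-below x ys ℕₚ.≤-refl (proj₂ (∧≡true ok))) (falling-no-pair x ys (proj₂ (∧≡true ok)))

falling-no-triple : ∀ {q} ys → Phased.accepts (falling q) ys ≡ true → anyTriple iso001 ys ≡ false
falling-no-triple []       _  = refl
falling-no-triple (y ∷ ys) ok =
  cong₂ _∨_ (falling-no-pair y ys (proj₂ (∧≡true ok))) (falling-no-triple ys (proj₂ (∧≡true ok)))

rising-no-pair : ∀ x {p} ys → x ≤ p → Phased.accepts (rising p) ys ≡ true → anyPair (iso001 x) ys ≡ false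
rising-no-pair x     []       _   _  = refl
rising-no-pair x {p} (y ∷ ys) x≤p ok with y ≤ᵇ p in y≤ᵇp
... | true  = cong₂ _∨_ (falling-below x ys ℕₚ.≤-refl (proj₂ (∧≡true ok))) (falling-no-pair x ys (proj₂ (∧≡true ok)))
... | false = cong₂ _∨_ (any-false (λ z → iso001-≢ z (ℕₚ.<⇒≢ x<y)) ys)
                        (rising-no-pair x ys (ℕₚ.<⇒≤ x<y) (proj₂ (∧≡true ok)))
  where
  x<y : x < y
  x<y = ℕₚ.≤-<-trans x≤p (≤ᵇ≡false⇒> y≤ᵇp)

rising-no-triple : ∀ {p} ys → Phased.accepts (rising p) ys ≡ true → anyTriple iso001 ys ≡ false
rising-no-triple     []       _  = refl
rising-no-triple {p} (y ∷ ys) ok with y ≤ᵇ p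
... | true  = cong₂ _∨_ (falling-no-pair y ys (proj₂ (∧≡true ok))) (falling-no-triple ys (proj₂ (∧≡true ok)))
... | false = cong₂ _∨_ (rising-no-pair y ys ℕₚ.≤-refl (proj₂ (∧≡true ok))) (rising-no-triple ys (proj₂ (∧≡true ok)))

catalanStep-head : ∀ {q z} zs → catalanStep q (z ∷ zs) ≡ true → z ≤ suc q
catalanStep-head {q} {z} zs = ≤ᵇ≡true⇒≤ ∘ proj₁ ∘ ∧≡true {z ≤ᵇ suc q}

catalanStep-tail : ∀ {q z} zs → catalanStep q (z ∷ zs) ≡ true → catalanStep z zs ≡ true
catalanStep-tail {q} {z} zs = proj₂ ∘ ∧≡true {z ≤ᵇ suc q}

allowed001⇒catalanStep : ∀ s y → allowed001 s y ≡ true → (y ≤ᵇ suc (phaseLetter s)) ≡ true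
allowed001⇒catalanStep (rising p)  y allowed = trans (sym (<ᵇ-suc y (suc p))) allowed
allowed001⇒catalanStep (falling q) y allowed = ≤⇒≤ᵇ≡true (ℕₚ.<⇒≤ (<ᵇ≡true⇒< {y} {suc q} allowed))

accepted001⇒catalanStep : ∀ s ys → Phased.accepts s ys ≡ true → catalanStep (phaseLetter s) ys ≡ true
accepted001⇒catalanStep s []       _  = refl
accepted001⇒catalanStep s (y ∷ ys) ok with allowed , ok′ ← ∧≡true {allowed001 s y} ok =
  cong₂ _∧_ (allowed001⇒catalanStep s y allowed)
            (subst (λ l → catalanStep l ys ≡ true) (phaseLetter-step001 s y) (accepted001⇒catalanStep (step001 s y) ys ok′))

rising-allowed : ∀ {p} y ys → catalanStep p (y ∷ ys) ≡ true → allowed001 (rising p) y ≡ true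
rising-allowed {p} y ys cat = trans (<ᵇ-suc y (suc p)) (≤⇒≤ᵇ≡true (catalanStep-head ys cat))

-- Each alternative makes the prefix 0 1 … (p-1) ++ w contain 001: the second one pairs the
-- letter v < p of w with its earlier occurrence in the prefix.
Contains001After : ℕ → List ℕ → Set
Contains001After p w = anyTriple iso001 w ≡ true ⊎ Σ ℕ (λ v → v < p × anyPair (iso001 v) w ≡ true)

contains001After-∷ : ∀ {u p} xs → u ≤ p → anyPair (iso001 u) xs ≡ true → Contains001After p (p ∷ xs)
contains001After-∷ {u} {p} xs u≤p pair with ℕₚ.m≤n⇒m<n∨m≡n u≤p
... | inj₁ u<p  = inj₂ (u , u<p , trans (cong (any (iso001 u p) xs ∨_) pair) (∨-zeroʳ _))
... | inj₂ refl = inj₁ (cong (_∨ anyTriple iso001 xs) pair)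

contains001After-step : ∀ {p} xs → Contains001After (suc p) xs → Contains001After p (p ∷ xs)
contains001After-step {p} xs (inj₁ triple)              = inj₁ (trans (cong (anyPair (iso001 p) xs ∨_) triple) (∨-zeroʳ _))
contains001After-step     xs (inj₂ (v , v<p+1 , pair)) = contains001After-∷ xs (ℕₚ.m<1+n⇒m≤n v<p+1) pair

-- In the falling phase the only possible violation is a letter q + 1 right after q.
falling-rejected : ∀ {q} ys → catalanStep q ys ≡ true → Phased.accepts (falling q) ys ≡ false →
                   Σ ℕ (λ u → u ≤ q × anyPair (iso001 u) (q ∷ ys) ≡ true)
falling-rejected     []       _   ()
falling-rejected {q} (z ∷ zs) cat rej with z <ᵇ suc q in z<ᵇq+1
... | true  with u , u≤z , pair ← falling-rejected zs (catalanStep-tail zs cat) rej =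
  u , ℕₚ.≤-trans u≤z (ℕₚ.m<1+n⇒m≤n (<ᵇ≡true⇒< z<ᵇq+1)) ,
  trans (cong (any (iso001 u q) (z ∷ zs) ∨_) pair) (∨-zeroʳ _)
... | false with refl ← ℕₚ.≤-antisym (catalanStep-head zs cat) (<ᵇ≡false⇒≥ {z} z<ᵇq+1) =
  q , ℕₚ.≤-refl , cong (λ b → (b ∨ any (iso001 q q) zs) ∨ anyPair (iso001 q) (suc q ∷ zs)) (iso001-repeat-rise q)

rising-rejected : ∀ {p} xs → catalanStep p xs ≡ true → Phased.accepts (rising p) xs ≡ false →
                  Contains001After p (p ∷ xs)
rising-rejected     []       _   ()
rising-rejected {p} (y ∷ ys) cat rej with y ≤ᵇ p in y≤ᵇp
... | true
  with u , u≤y , pair ← falling-rejected ys (catalanStep-tail ys cat) (true∧≡false (rising-allowed y ys cat) rej) =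
  contains001After-∷ (y ∷ ys) (ℕₚ.≤-trans u≤y (≤ᵇ≡true⇒≤ y≤ᵇp)) pair
... | false with refl ← ℕₚ.≤-antisym (catalanStep-head ys cat) (≤ᵇ≡false⇒> {y} y≤ᵇp) =
  contains001After-step (y ∷ ys)
    (rising-rejected ys (catalanStep-tail ys cat) (true∧≡false (rising-allowed y ys cat) rej))

avoid-001-characterisation : ∀ w → isCatalan w ∧ avoids w (0 ∷ 0 ∷ 1 ∷ []) ≡ zeroThen (Phased.accepts (rising 0)) w
avoid-001-characterisation []          = refl
avoid-001-characterisation (suc _ ∷ _) = refl
avoid-001-characterisation (zero ∷ xs) rewrite contains-triple 0 0 1 (zero ∷ xs)
  with Phased.accepts (rising 0) xs in ok
... | true  = cong₂ (λ u v → u ∧ not v) (accepted001⇒catalanStep (rising 0) xs ok)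
                    (cong₂ _∨_ (rising-no-pair 0 xs z≤n ok) (rising-no-triple xs ok))
... | false with catalanStep 0 xs in cat
...   | false = refl
...   | true with rising-rejected xs cat ok
...     | inj₁ triple      = cong not triple
...     | inj₂ (_ , () , _)

-- multichoose p k = C(p + k, k), the number of weakly decreasing words of length k over {0, …, p}.
multichoose : ℕ → ℕ → ℕ
multichoose zero    k       = 1
multichoose (suc p) zero    = 1
multichoose (suc p) (suc k) = multichoose (suc p) k + multichoose p (suc k)

multichoose-0 : ∀ p → multichoose p 0 ≡ 1
multichoose-0 zero    = refl
multichoose-0 (suc p) = refl

multichoose-1 : ∀ p → multichoose p 1 ≡ suc p
multichoose-1 zero    = refl
multichoose-1 (suc p) = cong suc (multichoose-1 p)

sumBelow-multichoose : ∀ p k → sumBelow (suc p) (λ a → multichoose a k) ≡ multichoose p (suc k)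
sumBelow-multichoose zero    k = refl
sumBelow-multichoose (suc p) k = begin
  sumBelow (suc (suc p)) (λ a → multichoose a k)  ≡⟨ sumBelow-last (suc p) (λ a → multichoose a k) ⟩
  sumBelow (suc p) (λ a → multichoose a k) + multichoose (suc p) k
                                                  ≡⟨ cong (_+ multichoose (suc p) k) (sumBelow-multichoose p k) ⟩
  multichoose p (suc k) + multichoose (suc p) k   ≡⟨ ℕₚ.+-comm (multichoose p (suc k)) _ ⟩
  multichoose (suc p) (suc k)                     ∎
  where open ≡-Reasoning

mutual
  multichoose-absorbʳ : ∀ p k → suc k * multichoose p (suc k) ≡ (p + suc k) * multichoose p k
  multichoose-absorbʳ zero    k       = refl
  multichoose-absorbʳ (suc p) zero    = begin
    1 * multichoose (suc p) 1  ≡⟨ ℕₚ.*-identityˡ _ ⟩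
    multichoose (suc p) 1      ≡⟨ multichoose-1 (suc p) ⟩
    suc (suc p)                ≡⟨ cong suc (ℕₚ.+-comm 1 p) ⟩
    suc p + 1                  ≡⟨ ℕₚ.*-identityʳ (suc p + 1) ⟨
    (suc p + 1) * 1            ∎
    where open ≡-Reasoning
  multichoose-absorbʳ (suc p) (suc k) = begin
    suc (suc k) * (multichoose (suc p) (suc k) + multichoose p (suc (suc k)))
      ≡⟨ ℕₚ.*-distribˡ-+ (suc (suc k)) (multichoose (suc p) (suc k)) _ ⟩
    suc (suc k) * multichoose (suc p) (suc k) + suc (suc k) * multichoose p (suc (suc k))
      ≡⟨ cong (suc (suc k) * multichoose (suc p) (suc k) +_) (multichoose-absorbʳ p (suc k)) ⟩
    suc (suc k) * multichoose (suc p) (suc k) + (p + suc (suc k)) * multichoose p (suc k)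
      ≡⟨ cong (λ n → suc (suc k) * multichoose (suc p) (suc k) + n * multichoose p (suc k)) (ℕₚ.+-suc p (suc k)) ⟩
    suc (suc k) * multichoose (suc p) (suc k) + (suc p + suc k) * multichoose p (suc k)
      ≡⟨ cong (suc (suc k) * multichoose (suc p) (suc k) +_) (multichoose-absorbˡ p (suc k)) ⟨
    suc (suc k) * multichoose (suc p) (suc k) + suc p * multichoose (suc p) (suc k)
      ≡⟨ ℕₚ.*-distribʳ-+ (multichoose (suc p) (suc k)) (suc (suc k)) (suc p) ⟨
    (suc (suc k) + suc p) * multichoose (suc p) (suc k)
      ≡⟨ cong (_* multichoose (suc p) (suc k)) (ℕₚ.+-comm (suc (suc k)) (suc p)) ⟩
    (suc p + suc (suc k)) * multichoose (suc p) (suc k) ∎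
    where open ≡-Reasoning

  multichoose-absorbˡ : ∀ p k → suc p * multichoose (suc p) k ≡ (suc p + k) * multichoose p k
  multichoose-absorbˡ p zero    = begin
    suc p * 1               ≡⟨ cong (suc p *_) (multichoose-0 p) ⟨
    suc p * multichoose p 0 ≡⟨ cong (_* multichoose p 0) (ℕₚ.+-identityʳ (suc p)) ⟨
    (suc p + 0) * multichoose p 0 ∎
    where open ≡-Reasoning
  multichoose-absorbˡ p (suc k) = begin
    suc p * (multichoose (suc p) k + multichoose p (suc k))
      ≡⟨ ℕₚ.*-distribˡ-+ (suc p) (multichoose (suc p) k) _ ⟩
    suc p * multichoose (suc p) k + suc p * multichoose p (suc k)
      ≡⟨ cong (_+ suc p * multichoose p (suc k)) (multichoose-absorbˡ p k) ⟩
    (suc p + k) * multichoose p k + suc p * multichoose p (suc k)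
      ≡⟨ cong (λ n → n * multichoose p k + suc p * multichoose p (suc k)) (ℕₚ.+-suc p k) ⟨
    (p + suc k) * multichoose p k + suc p * multichoose p (suc k)
      ≡⟨ cong (_+ suc p * multichoose p (suc k)) (multichoose-absorbʳ p k) ⟨
    suc k * multichoose p (suc k) + suc p * multichoose p (suc k)
      ≡⟨ ℕₚ.*-distribʳ-+ (multichoose p (suc k)) (suc k) (suc p) ⟨
    (suc k + suc p) * multichoose p (suc k)
      ≡⟨ cong (_* multichoose p (suc k)) (ℕₚ.+-comm (suc k) (suc p)) ⟩
    (suc p + suc k) * multichoose p (suc k) ∎
    where open ≡-Reasoning

risingCount : ℕ → ℕ → ℕ
risingCount p zero    = 1
risingCount p (suc k) = multichoose p (suc k) + risingCount (suc p) k

risingCount-suc : ∀ p k → risingCount (suc p) (suc k) ≡ 2 * risingCount (suc p) k + multichoose p (suc k)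
risingCount-suc p zero    = rearrange (multichoose p 1)
  where
  rearrange : ∀ x → (1 + x) + 1 ≡ 2 * 1 + x
  rearrange = solve-∀
risingCount-suc p (suc k) = begin
  multichoose (suc p) (suc (suc k)) + risingCount (suc (suc p)) (suc k)
    ≡⟨ cong (multichoose (suc p) (suc (suc k)) +_) (risingCount-suc (suc p) k) ⟩
  (multichoose (suc p) (suc k) + multichoose p (suc (suc k)))
    + (2 * risingCount (suc (suc p)) k + multichoose (suc p) (suc k))
    ≡⟨ rearrange (multichoose (suc p) (suc k)) (multichoose p (suc (suc k))) (risingCount (suc (suc p)) k) ⟩
  2 * (multichoose (suc p) (suc k) + risingCount (suc (suc p)) k) + multichoose p (suc (suc k)) ∎
  where
  open ≡-Reasoning
  rearrange : ∀ x y z → (x + y) + (2 * z + x) ≡ 2 * (x + z) + y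
  rearrange = solve-∀

risingCount-0 : ∀ k → risingCount 0 k ≡ 2 ^ k
risingCount-0 zero          = refl
risingCount-0 (suc zero)    = refl
risingCount-0 (suc (suc k)) = begin
  1 + risingCount 1 (suc k)            ≡⟨ cong (1 +_) (risingCount-suc 0 k) ⟩
  1 + (2 * risingCount 1 k + 1)        ≡⟨ rearrange (risingCount 1 k) ⟩
  2 * (1 + risingCount 1 k)            ≡⟨ cong (2 *_) (risingCount-0 (suc k)) ⟩
  2 ^ suc (suc k)                      ∎
  where
  open ≡-Reasoning
  rearrange : ∀ x → 1 + (2 * x + 1) ≡ 2 * (1 + x)
  rearrange = solve-∀

fallingDescents : ℕ → ℕ → ℕ
fallingDescents zero    k = 0
fallingDescents (suc q) k = k * multichoose q k

risingDescents : ℕ → ℕ → ℕ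
risingDescents p zero    = 0
risingDescents p (suc k) = fallingDescents p (suc k) + risingDescents (suc p) k

risingDescents-closed : ∀ p k → risingDescents (suc p) (suc k) ≡ (p + suc k) * risingCount p k
risingDescents-closed p zero    = begin
  1 * multichoose p 1 + 0 ≡⟨ ℕₚ.+-identityʳ _ ⟩
  1 * multichoose p 1     ≡⟨ ℕₚ.*-identityˡ _ ⟩
  multichoose p 1         ≡⟨ multichoose-1 p ⟩
  suc p                   ≡⟨ ℕₚ.+-comm 1 p ⟩
  p + 1                   ≡⟨ ℕₚ.*-identityʳ (p + 1) ⟨
  (p + 1) * 1             ∎
  where open ≡-Reasoning
risingDescents-closed p (suc k) = begin
  suc (suc k) * multichoose p (suc (suc k)) + risingDescents (suc (suc p)) (suc k)
    ≡⟨ cong₂ _+_ (multichoose-absorbʳ p (suc k)) (risingDescents-closed (suc p) k) ⟩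
  (p + suc (suc k)) * multichoose p (suc k) + (suc p + suc k) * risingCount (suc p) k
    ≡⟨ cong (λ n → (p + suc (suc k)) * multichoose p (suc k) + n * risingCount (suc p) k) (ℕₚ.+-suc p (suc k)) ⟨
  (p + suc (suc k)) * multichoose p (suc k) + (p + suc (suc k)) * risingCount (suc p) k
    ≡⟨ ℕₚ.*-distribˡ-+ (p + suc (suc k)) (multichoose p (suc k)) _ ⟨
  (p + suc (suc k)) * risingCount p (suc k) ∎
  where open ≡-Reasoning

risingDescents-0 : ∀ j → risingDescents 0 (suc (suc j)) ≡ suc j * 2 ^ j
risingDescents-0 j = trans (risingDescents-closed 0 j) (cong (suc j *_) (risingCount-0 j))

fallingDescents-suc : ∀ q k → sumBelow q (λ a → multichoose a k) + sumBelow (suc q) (λ a → fallingDescents a k)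
                            ≡ fallingDescents q (suc k)
fallingDescents-suc zero    k = refl
fallingDescents-suc (suc q) k =
  cong₂ _+_ (sumBelow-multichoose q k)
            (trans (sumBelow-* (suc q) k (λ a → multichoose a k)) (cong (k *_) (sumBelow-multichoose q k)))

rising-bounds : ∀ {p k m} → p + suc k < m → suc (suc p) ≤ m × suc p + k < m
rising-bounds {p} {k} {m} p+k+1<m = ℕₚ.≤-trans (s≤s (s≤s (ℕₚ.m≤m+n p k))) p+k+1<m′ , p+k+1<m′
  where
  p+k+1<m′ : suc p + k < m
  p+k+1<m′ = subst (_< m) (ℕₚ.+-suc p k) p+k+1<m

module PhasedCounts {m : ℕ} where
  open Phased using (count; descents; count-suc; descents-suc)
  open ≡-Reasoning

  count-falling : ∀ {q} k → q < m → count m (falling q) k ≡ multichoose q k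
  count-falling {q} zero    _   = sym (multichoose-0 q)
  count-falling {q} (suc k) q<m = begin
    count m (falling q) (suc k)                     ≡⟨ count-suc m (falling q) k ⟩
    sumBelow m _                                    ≡⟨ sumBelow-truncate (λ a → count m (falling a) k) q<m ⟩
    sumBelow (suc q) (λ a → count m (falling a) k)  ≡⟨ sumBelow-cong (suc q) (λ a a≤q → count-falling k (ℕₚ.<-≤-trans a≤q q<m)) ⟩
    sumBelow (suc q) (λ a → multichoose a k)        ≡⟨ sumBelow-multichoose q k ⟩
    multichoose q (suc k)                           ∎

  count-rising : ∀ {p} k → p + k < m → count m (rising p) k ≡ risingCount p k
  count-rising      zero    _         = refl
  count-rising {p} (suc k) p+k+1<m with p+2≤m , p+1+k<m ← rising-bounds p+k+1<m = begin
    count m (rising p) (suc k)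
      ≡⟨ count-suc m (rising p) k ⟩
    sumBelow m _
      ≡⟨ sumBelow-truncate (λ a → count m (step001 (rising p) a) k) p+2≤m ⟩
    sumBelow (suc (suc p)) (λ a → count m (step001 (rising p) a) k)
      ≡⟨ sumBelow-last (suc p) (λ a → count m (step001 (rising p) a) k) ⟩
    sumBelow (suc p) (λ a → count m (step001 (rising p) a) k) + count m (step001 (rising p) (suc p)) k
      ≡⟨ cong₂ _+_ (sumBelow-cong (suc p) (λ a a≤p → cong (λ s → count m s k) (step001-≤ (ℕₚ.m<1+n⇒m≤n a≤p))))
                   (cong (λ s → count m s k) (step001-suc p)) ⟩
    sumBelow (suc p) (λ a → count m (falling a) k) + count m (rising (suc p)) k
      ≡⟨ cong₂ _+_ (sumBelow-cong (suc p) (λ a a≤p → count-falling k (ℕₚ.<-≤-trans a≤p (ℕₚ.<⇒≤ p+2≤m))))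
                   (count-rising k p+1+k<m) ⟩
    sumBelow (suc p) (λ a → multichoose a k) + risingCount (suc p) k
      ≡⟨ cong (_+ risingCount (suc p) k) (sumBelow-multichoose p k) ⟩
    risingCount p (suc k) ∎

  mutual
    descents-falling : ∀ {q} k → q < m → descents m (falling q) k ≡ fallingDescents q k
    descents-falling {zero}  zero    _   = refl
    descents-falling {suc q} zero    _   = refl
    descents-falling {q}     (suc k) q<m =
      trans (descents-suc m (falling q) k)
            (trans (sumBelow-truncate (λ a → (if a <ᵇ q then count m (falling a) k else 0) + descents m (falling a) k) q<m)
                   (descents-falling-letters k q<m))

    descents-falling-letters : ∀ {q} k → q < m →
      sumBelow (suc q) (λ a → (if a <ᵇ q then count m (falling a) k else 0) + descents m (falling a) k)
      ≡ fallingDescents q (suc k)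
    descents-falling-letters {q} k q<m = begin
      sumBelow (suc q) (λ a → (if a <ᵇ q then count m (falling a) k else 0) + descents m (falling a) k)
        ≡⟨ sumBelow-cong (suc q) (λ a a≤q → cong₂ (λ c d → (if a <ᵇ q then c else 0) + d)
                                                   (count-falling k (a<m a≤q)) (descents-falling k (a<m a≤q))) ⟩
      sumBelow (suc q) (λ a → (if a <ᵇ q then multichoose a k else 0) + fallingDescents a k)
        ≡⟨ sumBelow-+ (suc q) (λ a → if a <ᵇ q then multichoose a k else 0) (λ a → fallingDescents a k) ⟩
      sumBelow (suc q) (λ a → if a <ᵇ q then multichoose a k else 0) + sumBelow (suc q) (λ a → fallingDescents a k)
        ≡⟨ cong (_+ sumBelow (suc q) (λ a → fallingDescents a k)) (sumBelow-truncate (λ a → multichoose a k) (ℕₚ.n≤1+n q)) ⟩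
      sumBelow q (λ a → multichoose a k) + sumBelow (suc q) (λ a → fallingDescents a k)
        ≡⟨ fallingDescents-suc q k ⟩
      fallingDescents q (suc k) ∎
      where
      a<m : ∀ {a} → a < suc q → a < m
      a<m a≤q = ℕₚ.<-≤-trans a≤q q<m

  descents-rising : ∀ {p} k → p + k < m → descents m (rising p) k ≡ risingDescents p k
  descents-rising      zero    _         = refl
  descents-rising {p} (suc k) p+k+1<m with p+2≤m , p+1+k<m ← rising-bounds p+k+1<m = begin
    descents m (rising p) (suc k)
      ≡⟨ descents-suc m (rising p) k ⟩
    sumBelow m _
      ≡⟨ sumBelow-truncate F p+2≤m ⟩
    sumBelow (suc (suc p)) F
      ≡⟨ sumBelow-last (suc p) F ⟩
    sumBelow (suc p) F + F (suc p)
      ≡⟨ cong₂ _+_ (sumBelow-cong (suc p) (λ a a≤p → cong (λ s → (if a <ᵇ p then count m s k else 0) + descents m s k)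
                                                           (step001-≤ (ℕₚ.m<1+n⇒m≤n a≤p))))
                   (cong₂ (λ b s → (if b then count m s k else 0) + descents m s k) (suc<ᵇ p) (step001-suc p)) ⟩
    sumBelow (suc p) (λ a → (if a <ᵇ p then count m (falling a) k else 0) + descents m (falling a) k)
      + descents m (rising (suc p)) k
      ≡⟨ cong₂ _+_ (descents-falling-letters k (ℕₚ.<-≤-trans (ℕₚ.n<1+n p) (ℕₚ.<⇒≤ p+2≤m))) (descents-rising k p+1+k<m) ⟩
    risingDescents p (suc k) ∎
    where
    F : ℕ → ℕ
    F a = (if a <ᵇ p then count m (step001 (rising p) a) k else 0) + descents m (step001 (rising p) a) k

popularity : ℕ → ℕ
popularity (suc (suc (suc j))) = suc j * 2 ^ j
popularity _                   = 0

popularity-doubled : ∀ n → 2 ≤ n → 2 * popularity n ≡ (n ∸ 2) * 2 ^ (n ∸ 2)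
popularity-doubled (suc zero)          (s≤s ())
popularity-doubled (suc (suc zero))    _ = refl
popularity-doubled (suc (suc (suc j))) _ = rearrange j (2 ^ j)
  where
  rearrange : ∀ j x → 2 * (suc j * x) ≡ suc j * (2 * x)
  rearrange = solve-∀

⊛-congˡ : ∀ {f f′ : PowerSeries} (g : PowerSeries) → (∀ n → f n ≡ f′ n) → ∀ n → (f ⊛ g) n ≡ (f′ ⊛ g) n
⊛-congˡ {f} {f′} g f≗f′ n = convSum-cong n
  where
  convSum-cong : ∀ k → convSum f g n k ≡ convSum f′ g n k
  convSum-cong zero    = cong (ℤ._* g n) (f≗f′ 0)
  convSum-cong (suc k) = cong₂ ℤ._+_ (cong (ℤ._* g (n ∸ suc k)) (f≗f′ (suc k))) (convSum-cong k)

oneMinusTwoX-∸ : ∀ N j → 2 + j ≤ N → oneMinusTwoX (N ∸ j) ≡ ℤ.+ 0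
oneMinusTwoX-∸ (suc (suc N)) zero    _         = refl
oneMinusTwoX-∸ (suc N)       (suc j) (s≤s 2+j≤N) = oneMinusTwoX-∸ N j 2+j≤N

convSum-oneMinusTwoX-tail : ∀ f N k → 2 + k ≤ N → convSum f oneMinusTwoX N k ≡ ℤ.+ 0
convSum-oneMinusTwoX-tail f N zero    2≤N =
  trans (cong (f 0 ℤ.*_) (oneMinusTwoX-∸ N 0 2≤N)) (ℤₚ.*-zeroʳ (f 0))
convSum-oneMinusTwoX-tail f N (suc k) 3+k≤N =
  cong₂ ℤ._+_ (trans (cong (f (suc k) ℤ.*_) (oneMinusTwoX-∸ N (suc k) 3+k≤N)) (ℤₚ.*-zeroʳ (f (suc k))))
              (convSum-oneMinusTwoX-tail f N k (ℕₚ.≤-trans (ℕₚ.n≤1+n (2 + k)) 3+k≤N))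

⊛-oneMinusTwoX-suc : ∀ f n → (f ⊛ oneMinusTwoX) (suc n) ≡ f (suc n) ℤ.- ℤ.+ 2 ℤ.* f n
⊛-oneMinusTwoX-suc f zero    = rearrange (f 1) (f 0)
  where
  rearrange : ∀ x y → x ℤ.* ℤ.+ 1 ℤ.+ y ℤ.* ℤ.- ℤ.+ 2 ≡ x ℤ.- ℤ.+ 2 ℤ.* y
  rearrange = ℤ-Solver.solve-∀
⊛-oneMinusTwoX-suc f (suc n) = begin
  f (2 + n) ℤ.* oneMinusTwoX (n ∸ n) ℤ.+ rest
    ≡⟨ cong (λ c → f (2 + n) ℤ.* oneMinusTwoX c ℤ.+ rest) (ℕₚ.n∸n≡0 n) ⟩
  f (2 + n) ℤ.* ℤ.+ 1 ℤ.+ rest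
    ≡⟨ cong₂ (λ c t → f (2 + n) ℤ.* ℤ.+ 1 ℤ.+ (f (1 + n) ℤ.* oneMinusTwoX c ℤ.+ t))
             (ℕₚ.m+n∸n≡m 1 n) (convSum-oneMinusTwoX-tail f (2 + n) n ℕₚ.≤-refl) ⟩
  f (2 + n) ℤ.* ℤ.+ 1 ℤ.+ (f (1 + n) ℤ.* ℤ.- ℤ.+ 2 ℤ.+ ℤ.+ 0)
    ≡⟨ rearrange (f (2 + n)) (f (1 + n)) ⟩
  f (2 + n) ℤ.- ℤ.+ 2 ℤ.* f (1 + n) ∎
  where
  open ≡-Reasoning
  rest : ℤ.ℤ
  rest = f (1 + n) ℤ.* oneMinusTwoX (1 + n ∸ n) ℤ.+ convSum f oneMinusTwoX (2 + n) n
  rearrange : ∀ x y → x ℤ.* ℤ.+ 1 ℤ.+ (y ℤ.* ℤ.- ℤ.+ 2 ℤ.+ ℤ.+ 0) ≡ x ℤ.- ℤ.+ 2 ℤ.* y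
  rearrange = ℤ-Solver.solve-∀

-- Multiplying twice by 1 - 2x turns a sequence x into x(n) - 4 x(n-1) + 4 x(n-2).
second-difference : ∀ x y z c → x + 4 * z ≡ 4 * y + c →
  (ℤ.+ x ℤ.- ℤ.+ 2 ℤ.* ℤ.+ y) ℤ.- ℤ.+ 2 ℤ.* (ℤ.+ y ℤ.- ℤ.+ 2 ℤ.* ℤ.+ z) ≡ ℤ.+ c
second-difference x y z c eq = begin
  (ℤ.+ x ℤ.- ℤ.+ 2 ℤ.* ℤ.+ y) ℤ.- ℤ.+ 2 ℤ.* (ℤ.+ y ℤ.- ℤ.+ 2 ℤ.* ℤ.+ z)
    ≡⟨ rearrange (ℤ.+ x) (ℤ.+ y) (ℤ.+ z) ⟩
  (ℤ.+ x ℤ.+ ℤ.+ 4 ℤ.* ℤ.+ z) ℤ.- ℤ.+ 4 ℤ.* ℤ.+ y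
    ≡⟨ cong₂ ℤ._-_ (trans (cong (ℤ._+_ (ℤ.+ x)) (sym (ℤₚ.pos-* 4 z))) (sym (ℤₚ.pos-+ x (4 * z)))) (sym (ℤₚ.pos-* 4 y)) ⟩
  ℤ.+ (x + 4 * z) ℤ.- ℤ.+ (4 * y)
    ≡⟨ cong (λ l → ℤ.+ l ℤ.- ℤ.+ (4 * y)) eq ⟩
  ℤ.+ (4 * y + c) ℤ.- ℤ.+ (4 * y)
    ≡⟨ cong (ℤ._- ℤ.+ (4 * y)) (ℤₚ.pos-+ (4 * y) c) ⟩
  (ℤ.+ (4 * y) ℤ.+ ℤ.+ c) ℤ.- ℤ.+ (4 * y)
    ≡⟨ cancel (ℤ.+ (4 * y)) (ℤ.+ c) ⟩
  ℤ.+ c ∎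
  where
  open ≡-Reasoning
  rearrange : ∀ x y z → (x ℤ.- ℤ.+ 2 ℤ.* y) ℤ.- ℤ.+ 2 ℤ.* (y ℤ.- ℤ.+ 2 ℤ.* z) ≡ (x ℤ.+ ℤ.+ 4 ℤ.* z) ℤ.- ℤ.+ 4 ℤ.* y
  rearrange = ℤ-Solver.solve-∀
  cancel : ∀ u v → (u ℤ.+ v) ℤ.- u ≡ v
  cancel = ℤ-Solver.solve-∀

popularitySeries : PowerSeries
popularitySeries n = ℤ.+ popularity n

popularity-generatingFunction : ∀ n → ((popularitySeries ⊛ oneMinusTwoX) ⊛ oneMinusTwoX) n ≡ xCubed n
popularity-generatingFunction 0 = refl
popularity-generatingFunction 1 = refl
popularity-generatingFunction 2 = refl
popularity-generatingFunction 3 = refl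
popularity-generatingFunction 4 = refl
popularity-generatingFunction (suc (suc (suc (suc (suc j))))) = begin
  ((P ⊛ oneMinusTwoX) ⊛ oneMinusTwoX) (5 + j)
    ≡⟨ ⊛-oneMinusTwoX-suc (P ⊛ oneMinusTwoX) (4 + j) ⟩
  (P ⊛ oneMinusTwoX) (5 + j) ℤ.- ℤ.+ 2 ℤ.* (P ⊛ oneMinusTwoX) (4 + j)
    ≡⟨ cong₂ (λ u v → u ℤ.- ℤ.+ 2 ℤ.* v) (⊛-oneMinusTwoX-suc P (4 + j)) (⊛-oneMinusTwoX-suc P (3 + j)) ⟩
  (P (5 + j) ℤ.- ℤ.+ 2 ℤ.* P (4 + j)) ℤ.- ℤ.+ 2 ℤ.* (P (4 + j) ℤ.- ℤ.+ 2 ℤ.* P (3 + j))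
    ≡⟨ second-difference (popularity (5 + j)) (popularity (4 + j)) (popularity (3 + j)) 0 (identity j (2 ^ j)) ⟩
  ℤ.+ 0 ∎
  where
  open ≡-Reasoning
  P : PowerSeries
  P = popularitySeries
  identity : ∀ j x → (3 + j) * (2 * (2 * x)) + 4 * ((1 + j) * x) ≡ 4 * ((2 + j) * (2 * x)) + 0
  identity = solve-∀

Statistics : List ℕ → Set
Statistics p = (∀ k → length (C (suc k) p) ≡ 2 ^ k) × (∀ n → popDes n p ≡ popularity n)

statistics-012 : Statistics (0 ∷ 1 ∷ 2 ∷ [])
statistics-012 = count , popularity-012
  where
  p : List ℕ
  p = 0 ∷ 1 ∷ 2 ∷ []

  count : ∀ k → length (C (suc k) p) ≡ 2 ^ k
  count zero    = refl
  count (suc k) = trans (length-C p _ avoid-012-characterisation (suc k))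
                        (BinaryCounts.count-binary (s≤s (s≤s z≤n)) 0 (suc k))

  popularity-012 : ∀ n → popDes n p ≡ popularity n
  popularity-012 0 = refl
  popularity-012 1 = refl
  popularity-012 2 = refl
  popularity-012 (suc (suc (suc j))) =
    trans (popDes-C p _ avoid-012-characterisation (2 + j))
          (trans (BinaryCounts.descents-after-0 2≤m (suc j)) (BinaryCounts.descentsBoth-closed 2≤m j))
    where
    2≤m : 2 ≤ 3 + j
    2≤m = s≤s (s≤s z≤n)

statistics-001 : Statistics (0 ∷ 0 ∷ 1 ∷ [])
statistics-001 = count , popularity-001
  where
  p : List ℕ
  p = 0 ∷ 0 ∷ 1 ∷ []

  count : ∀ k → length (C (suc k) p) ≡ 2 ^ k
  count k = trans (length-C p _ avoid-001-characterisation k)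
                  (trans (PhasedCounts.count-rising k (ℕₚ.n<1+n k)) (risingCount-0 k))

  popularity-001 : ∀ n → popDes n p ≡ popularity n
  popularity-001 0 = refl
  popularity-001 1 = refl
  popularity-001 2 = refl
  popularity-001 (suc (suc (suc j))) =
    trans (popDes-C p _ avoid-001-characterisation (2 + j))
          (trans (PhasedCounts.descents-rising (2 + j) (ℕₚ.n<1+n (2 + j))) (risingDescents-0 j))

statistics : ∀ {p} → p ≡ 0 ∷ 1 ∷ 2 ∷ [] ⊎ p ≡ 0 ∷ 0 ∷ 1 ∷ [] → Statistics p
statistics (inj₁ refl) = statistics-012
statistics (inj₂ refl) = statistics-001

corollary3 : (p : List ℕ) → (p ≡ 0 ∷ 1 ∷ 2 ∷ [] ⊎ p ≡ 0 ∷ 0 ∷ 1 ∷ [])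
    → ((n : ℕ) → 1 ≤ n → length (C n p) ≡ 2 ^ (n ∸ 1))
    × ((n : ℕ) → 2 ≤ n → 2 * popDes n p ≡ (n ∸ 2) * 2 ^ (n ∸ 2))
    × ((n : ℕ) → ((descentGF p ⊛ oneMinusTwoX) ⊛ oneMinusTwoX) n ≡ xCubed n)
corollary3 p p≡012⊎001 =
  (λ { (suc k) _ → count k }) ,
  (λ n 2≤n → trans (cong (2 *_) (popDes≡popularity n)) (popularity-doubled n 2≤n)) ,
  (λ n → trans (⊛-congˡ oneMinusTwoX (⊛-congˡ oneMinusTwoX (cong ℤ.+_ ∘ popDes≡popularity)) n)
               (popularity-generatingFunction n))
  where
  count : ∀ k → length (C (suc k) p) ≡ 2 ^ k
  count = proj₁ (statistics p≡012⊎001)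

  popDes≡popularity : ∀ n → popDes n p ≡ popularity n
  popDes≡popularity = proj₂ (statistics p≡012⊎001)
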